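{- Let $\mathcal B=\mathcal B_1,\mathcal B_2,\ldots$ be the sequence of even binary partitions defined in the context, and let $k\ge1$. Then: (i) $|\mathcal B_k|$ is the smallest integer $n\ge0$ such that $k\le b(n)$. (ii) With $n=|\mathcal B_k|$, we have $\lfloor \mathcal B_k/2\rfloor=\mathcal B_\ell$, where $\ell=k-b(n-2)$ if $n\equiv0\pmod 4$, and $\ell=b(n)+1-k$ if $n\equiv 2\pmod 4$. Conversely, let $P$ be an even binary partition with trail $\tau=\tau_0,\tau_1,\tau_2,\ldots$, so that $\lfloor P/2\rfloor$ has trail $\tau_1,\tau_2,\ldots$. If $\lfloor P/2\rfloor=\mathcal B_\ell$, then $P=\mathcal B_k$ where $k=b(\tau_0-2)+\ell$ if $\tau_0\equiv0\pmod4$, and $k=b(\tau_0)+1-\ell$ if $\tau_0\equiv2\pmod4$. Together with the base case that the trail $0,0,\ldots$ (i.e. $P=\emptyset$) corresponds to $\mathcal B_{b(0)}=\mathcal B_1=\emptyset$, this recurrence determines the position in $\mathcal B$ of the even binary partition with any given trail.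
   Context: A binary partition of $n\ge0$ is a multiset of powers of two ($1,2,4,\dots$) summing to $n$; $\emptyset$ is the unique binary partition of $0$. Let $b(n)$ be the number of binary partitions of $n$, with the convention $b(m)=0$ for $m<0$. For a partition $P$, $|P|$ is the sum of its parts, $P+1$ denotes $P$ with an extra part $1$ added, and $2\times P$ denotes $P$ with every part doubled. Define ordered lists $\mathcal B(n)$ of all binary partitions of $n$ recursively: $\mathcal B(0)=(\emptyset)$; for $n\ge1$: - if $n$ is odd, $\mathcal B(n)$ is the list $(Q+1)$ for $Q$ running through $\mathcal B(n-1)$ in order; - if $n\equiv0\pmod 4$, $\mathcal B(n)$ is the list $(Q+1)$ for $Q$ running through $\mathcal B(n-1)$ in order, followed by $(2\times Q)$ for $Q$ running through $\mathcal B(n/2)$ in order; - if $n\equiv2\pmod 4$, $\mathcal B(n)$ is the list $(Q+1)$ for $Q$ running through $\mathcal B(n-1)$ in order, followed by $(2\times Q)$ for $Q$ running through $\mathcal B(n/2)$ in reverse order. An even binary partition is a binary partition with no part equal to $1$. The infinite sequence $\mathcal B=\mathcal B_1,\mathcal B_2,\dots$ is the concatenation, over $n=0,2,4,6,\dots$ in increasing order, of the blocks: for $n=0$ the single term $\emptyset$; for even $n\ge2$ the terms of $\mathcal B(n)$ having no part equal to $1$ (these are its last $b(n/2)$ terms), in the order they occur in $\mathcal B(n)$. For an even binary partition $P$, $\lfloor P/2\rfloor$ denotes the even binary partition obtained by halving every part of $P$ and then deleting all parts equal to $1$. The trail of $P$ is the sequence $\tau(P)=\tau_0,\tau_1,\tau_2,\ldots$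 with $\tau_i=|\lfloor P/2^i\rfloor|$, where $\lfloor P/2^i\rfloor$ denotes $i$ iterations of the map $P\mapsto\lfloor P/2\rfloor$ (so $\tau_0=|P|$). -}

module Defs where

open import Data.Nat using (ℕ; zero; suc; _+_; _*_; _∸_; _^_; _≤_; _≟_)
open import Data.Nat.DivMod using (_/_; _%_)
open import Data.List using (List; []; _∷_; [_]; map; _++_; reverse; filter; length; concatMap; upTo)
open import Data.Nat.ListAction using (sum)
open import Data.List.Membership.DecPropositional _≟_ using (_∈?_)
open import Data.List.Relation.Unary.All using (All)
open import Data.List.Relation.Unary.Linked using (Linked)
open import Data.List.Membership.Propositional using (_∈_)
open import Data.Maybe using (Maybe; just; nothing; fromMaybe)
open import Data.Product using (∃)
open import Relation.Binary.PropositionalEquality using (_≡_)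
open import Relation.Nullary using (¬_; ¬?)

-- A partition is represented canonically as a list of its parts in
-- nondecreasing order (so equality of multisets is equality of lists).
Partition : Set
Partition = List ℕ

IsPow2 : ℕ → Set
IsPow2 x = ∃ λ j → x ≡ 2 ^ j

IsBinaryPartition : Partition → Set
IsBinaryPartition P = Linked _≤_ P × All IsPow2 P
  where open import Data.Product using (_×_)

IsEvenBinaryPartition : Partition → Set
IsEvenBinaryPartition P = IsBinaryPartition P × ¬ (1 ∈ P)
  where open import Data.Product using (_×_)

∣_∣ₚ : Partition → ℕ
∣ P ∣ₚ = sum P

-- P + 1 (extra part 1; it is the smallest, so it goes in front)
plus1 : Partition → Partition
plus1 Q = 1 ∷ Q

times2 : Partition → Partition
times2 Q = map (2 *_) Q

Bf : ℕ → ℕ → List Partition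
Bf zero _ = []
Bf (suc f) zero = [ [] ]
Bf (suc f) (suc m) with suc m % 4
... | 0 = map plus1 (Bf f m) ++ map times2 (Bf f (suc m / 2))
... | 2 = map plus1 (Bf f m) ++ reverse (map times2 (Bf f (suc m / 2)))
... | _ = map plus1 (Bf f m)

-- the ordered list 𝓑(n) of all binary partitions of n
BL : ℕ → List Partition
BL n = Bf (suc n) n

b : ℕ → ℕ
b n = length (BL n)

-- b(n - 2) with the convention b(m) = 0 for m < 0
b₋₂ : ℕ → ℕ
b₋₂ zero = 0
b₋₂ (suc zero) = 0
b₋₂ (suc (suc n)) = b n

-- block of the sequence 𝓑 for even n (argument is n itself)
block : ℕ → List Partition
block zero = [ [] ]
block n@(suc _) = filter (λ Q → ¬? (1 ∈? Q)) (BL n)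

prefix : ℕ → List Partition
prefix m = concatMap (λ j → block (2 * j)) (upTo (suc m))

nth : {A : Set} → List A → ℕ → Maybe A
nth [] _ = nothing
nth (x ∷ xs) zero = just x
nth (x ∷ xs) (suc i) = nth xs i

-- 𝓑ₖ (1-indexed). Every block is nonempty, so prefix k has length > k - 1
-- and the default [] is never used for k ≥ 1.
𝓑 : ℕ → Partition
𝓑 k = fromMaybe [] (nth (prefix k) (k ∸ 1))

half : Partition → Partition
half P = filter (λ x → ¬? (x ≟ 1)) (map (_/ 2) P)

iter : ℕ → Partition → Partition
iter zero P = P
iter (suc i) P = half (iter i P)

trail : Partition → ℕ → ℕ
trail P i = ∣ iter i P ∣ₚ

-- 𝓑(n) is (𝓑(n−1) + 1) followed, for even n, by 2 × 𝓑(n/2), reversed when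
-- n ≡ 2 (mod 4).  Deleting the parts 1 from the members of 𝓑(2m) therefore
-- yields exactly the first m + 1 blocks of 𝓑, so the i-th member of any 𝓑(n)
-- drops to 𝓑_{i+1}, and the block of 𝓑 for 2m, namely 2 × 𝓑(m) in that
-- orientation, fills the positions b(2m−2) < k ≤ b(2m).  Halving a member of
-- this block and dropping its ones thus gives 𝓑_{l+1}, where l is its position
-- in 𝓑(m).  Conversely, a partition is determined by its sum and its parts
-- ≠ 1, which places ⌊P/2⌋ with its ones restored inside 𝓑(|P|/2).
module Submission where

open import Defs
open import Data.Nat
open import Data.Nat.Properties
open import Data.Nat.DivMod using (_/_; _%_; m*n/n≡m; m/n<m; /-monoˡ-≤; %-distribˡ-+; m%n<n; m%n*o≡m*o%[n*o])
open import Data.Nat.Induction using (<-rec)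
open import Data.Nat.ListAction using (sum)
open import Data.List using (List; []; _∷_; [_]; map; _++_; reverse; filter; length; replicate; upTo; concatMap)
open import Data.List.Properties
  using (++-identityʳ; ++-assoc; map-++; map-∘; map-cong; map-id; map-id-local; length-map; length-++; length-++-≤ˡ;
         length-reverse; unfold-reverse; filter-all; filter-none; filter-++; concatMap-++; upTo-∷ʳ)
open import Data.List.Membership.Propositional using (_∈_)
open import Data.List.Membership.DecPropositional _≟_ using (_∈?_)
open import Data.List.Membership.Propositional.Properties using (∈-map⁻)
open import Data.List.Relation.Unary.All as All using (All; []; _∷_)
open import Data.List.Relation.Unary.All.Properties using (map⁺; ++⁺; ¬Any⇒All¬)
open import Data.List.Relation.Unary.Any using (here)
open import Data.List.Relation.Unary.Linked as Linked using (Linked)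
open import Data.List.Relation.Unary.Linked.Properties using (Linked⇒All) renaming (map⁺ to Linked-map⁺)
open import Data.List.Relation.Binary.Permutation.Propositional using (↭-sym)
open import Data.List.Relation.Binary.Permutation.Propositional.Properties using (All-resp-↭; ↭-reverse)
open import Data.Maybe using (just; fromMaybe)
open import Data.Product using (∃-syntax; _×_; _,_; proj₁; proj₂)
open import Data.Sum using (_⊎_; inj₁; inj₂)
open import Data.Unit using (tt)
open import Data.Bool using (true; false)
open import Data.Empty using (⊥-elim)
open import Relation.Nullary using (¬_; ¬?; yes; no)
open import Function using (_∘_)
open import Relation.Binary.PropositionalEquality hiding ([_])
open ≡-Reasoning

module _ {A : Set} where

  nth-++ˡ : ∀ (xs ys : List A) {i} → i < length xs → nth (xs ++ ys) i ≡ nth xs i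
  nth-++ˡ (x ∷ xs) ys {zero}  _         = refl
  nth-++ˡ (x ∷ xs) ys {suc i} (s≤s i<n) = nth-++ˡ xs ys i<n

  nth-++ʳ : ∀ (xs ys : List A) i → nth (xs ++ ys) (length xs + i) ≡ nth ys i
  nth-++ʳ []       ys i = refl
  nth-++ʳ (x ∷ xs) ys i = nth-++ʳ xs ys i

  nth-< : ∀ (xs : List A) {i} → i < length xs → ∃[ x ] nth xs i ≡ just x
  nth-< (x ∷ xs) {zero}  _         = x , refl
  nth-< (x ∷ xs) {suc i} (s≤s i<n) = nth-< xs i<n

  nth-just⇒< : ∀ (xs : List A) {i x} → nth xs i ≡ just x → i < length xs
  nth-just⇒< (x ∷ xs) {zero}  _ = z<s
  nth-just⇒< (x ∷ xs) {suc i} e = s<s (nth-just⇒< xs e)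

  nth-All : ∀ {P : A → Set} {xs i x} → All P xs → nth xs i ≡ just x → P x
  nth-All {i = zero}  (px ∷ _)  refl = px
  nth-All {i = suc i} (_ ∷ pxs) e    = nth-All pxs e

  nth-reverse : ∀ (xs : List A) {i} → i < length xs → nth (reverse xs) i ≡ nth xs (length xs ∸ suc i)
  nth-reverse (x ∷ xs) {i} (s≤s i≤n) with m≤n⇒m<n∨m≡n i≤n
  ... | inj₁ i<n = begin
    nth (reverse (x ∷ xs)) i    ≡⟨ cong (λ zs → nth zs i) (unfold-reverse x xs) ⟩
    nth (reverse xs ++ [ x ]) i ≡⟨ nth-++ˡ (reverse xs) [ x ] (subst (i <_) (sym (length-reverse xs)) i<n) ⟩
    nth (reverse xs) i          ≡⟨ nth-reverse xs i<n ⟩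
    nth xs (length xs ∸ suc i)  ≡⟨ cong (nth (x ∷ xs)) (sym (+-∸-assoc 1 i<n)) ⟩
    nth (x ∷ xs) (length xs ∸ i) ∎
  ... | inj₂ refl = begin
    nth (reverse (x ∷ xs)) (length xs)                ≡⟨ cong₂ nth (unfold-reverse x xs) (sym (+-identityʳ _)) ⟩
    nth (reverse xs ++ [ x ]) (length xs + 0)         ≡⟨ cong (λ n → nth (reverse xs ++ [ x ]) (n + 0)) (sym (length-reverse xs)) ⟩
    nth (reverse xs ++ [ x ]) (length (reverse xs) + 0) ≡⟨ nth-++ʳ (reverse xs) [ x ] 0 ⟩
    just x                                            ≡⟨ cong (nth (x ∷ xs)) (sym (n∸n≡0 (length xs))) ⟩
    nth (x ∷ xs) (length xs ∸ length xs)              ∎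

∸-suc-< : ∀ {i n} → i < n → n ∸ suc i < n
∸-suc-< {i} {suc n} _ = s≤s (m∸n≤m n i)

∸-suc-involutive : ∀ {i n} → i < n → n ∸ suc (n ∸ suc i) ≡ i
∸-suc-involutive {i} {suc n} (s≤s i≤n) = m∸[m∸n]≡n i≤n

nth-reverse-mirror : ∀ {A : Set} (xs : List A) {i x} → nth xs i ≡ just x → nth (reverse xs) (length xs ∸ suc i) ≡ just x
nth-reverse-mirror xs {i} {x} e = begin
  nth (reverse xs) (length xs ∸ suc i)                  ≡⟨ nth-reverse xs (∸-suc-< i<n) ⟩
  nth xs (length xs ∸ suc (length xs ∸ suc i))          ≡⟨ cong (nth xs) (∸-suc-involutive i<n) ⟩
  nth xs i                                              ≡⟨ e ⟩
  just x                                                ∎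
  where i<n = nth-just⇒< xs e

nth-map-just : ∀ {A B : Set} (f : A → B) (xs : List A) {i x} → nth xs i ≡ just x → nth (map f xs) i ≡ just (f x)
nth-map-just f (x ∷ xs) {zero}  refl = refl
nth-map-just f (x ∷ xs) {suc i} e    = nth-map-just f xs e

data EvenOdd : ℕ → Set where
  even : ∀ m → EvenOdd (2 * m)
  odd  : ∀ m → EvenOdd (suc (2 * m))

evenOdd : ∀ n → EvenOdd n
evenOdd zero = even 0
evenOdd (suc n) with evenOdd n
... | even m = odd m
... | odd m  = subst EvenOdd (*-suc 2 m) (even (suc m))

double/2 : ∀ m → 2 * m / 2 ≡ m
double/2 m = trans (cong (_/ 2) (*-comm 2 m)) (m*n/n≡m m 2)

double%4 : ∀ m → 2 * m % 4 ≡ 0 ⊎ 2 * m % 4 ≡ 2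
double%4 m with m % 2 | m%n<n m 2 | m%n*o≡m*o%[n*o] m 2 2
... | 0 | _ | e = inj₁ (trans (cong (_% 4) (*-comm 2 m)) (sym e))
... | 1 | _ | e = inj₂ (trans (cong (_% 4) (*-comm 2 m)) (sym e))
... | suc (suc _) | s≤s (s≤s ()) | _

suc/2<suc : ∀ n → suc n / 2 < suc n
suc/2<suc n = m/n<m (suc n) 2 (s≤s (s≤s z≤n))

Bf-fuel : ∀ f g n → n < f → n < g → Bf f n ≡ Bf g n
Bf-fuel (suc f) (suc g) zero    _         _         = refl
Bf-fuel (suc f) (suc g) (suc m) (s≤s m<f) (s≤s m<g) with suc m % 4
... | 0 = cong₂ _++_ (cong (map plus1) (Bf-fuel f g m m<f m<g))
                     (cong (map times2) (Bf-fuel f g (suc m / 2) (≤-<-trans h m<f) (≤-<-trans h m<g)))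
  where h = ≤-pred (suc/2<suc m)
... | 1 = cong (map plus1) (Bf-fuel f g m m<f m<g)
... | 2 = cong₂ _++_ (cong (map plus1) (Bf-fuel f g m m<f m<g))
                     (cong (reverse ∘ map times2) (Bf-fuel f g (suc m / 2) (≤-<-trans h m<f) (≤-<-trans h m<g)))
  where h = ≤-pred (suc/2<suc m)
... | suc (suc (suc _)) = cong (map plus1) (Bf-fuel f g m m<f m<g)

doubledPart : ℕ → List Partition → List Partition
doubledPart 0 ys = map times2 ys
doubledPart 2 ys = reverse (map times2 ys)
doubledPart _ ys = []

BL-suc : ∀ n → BL (suc n) ≡ map plus1 (BL n) ++ doubledPart (suc n % 4) (BL (suc n / 2))
BL-suc n with suc n % 4
... | 0 = cong (λ ys → map plus1 (BL n) ++ map times2 ys) (Bf-fuel (suc n) (suc (suc n / 2)) (suc n / 2) (suc/2<suc n) ≤-refl)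
... | 1 = sym (++-identityʳ _)
... | 2 = cong (λ ys → map plus1 (BL n) ++ reverse (map times2 ys)) (Bf-fuel (suc n) (suc (suc n / 2)) (suc n / 2) (suc/2<suc n) ≤-refl)
... | suc (suc (suc _)) = sym (++-identityʳ _)

doubledPart-odd : ∀ m ys → doubledPart (suc (2 * m) % 4) ys ≡ []
doubledPart-odd m ys = trans (cong (λ r → doubledPart r ys) (%-distribˡ-+ 1 (2 * m) 4)) (odd-residue (double%4 m))
  where
  odd-residue : 2 * m % 4 ≡ 0 ⊎ 2 * m % 4 ≡ 2 → doubledPart ((1 + 2 * m % 4) % 4) ys ≡ []
  odd-residue (inj₁ e) rewrite e = refl
  odd-residue (inj₂ e) rewrite e = refl

length-doubledPart : ∀ m ys → length (doubledPart (2 * m % 4) ys) ≡ length ys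
length-doubledPart m ys with double%4 m
... | inj₁ e rewrite e = length-map times2 ys
... | inj₂ e rewrite e = trans (length-reverse (map times2 ys)) (length-map times2 ys)

All-doubledPart : ∀ {Q P : Partition → Set} → (∀ {y} → Q y → P (times2 y)) → ∀ r {ys} → All Q ys → All P (doubledPart r ys)
All-doubledPart f 0 qs = map⁺ (All.map f qs)
All-doubledPart f 1 qs = []
All-doubledPart f 2 qs = All-resp-↭ (↭-sym (↭-reverse _)) (map⁺ (All.map f qs))
All-doubledPart f (suc (suc (suc _))) qs = []

All-doubledPart-times2 : ∀ {P : Partition → Set} → (∀ y → P (times2 y)) → ∀ r ys → All P (doubledPart r ys)
All-doubledPart-times2 f r ys = All-doubledPart (λ {y} _ → f y) r (All.universal (λ _ → tt) ys)

BL-odd : ∀ m → BL (suc (2 * m)) ≡ map plus1 (BL (2 * m))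
BL-odd m = begin
  BL (suc (2 * m))                                           ≡⟨ BL-suc (2 * m) ⟩
  map plus1 (BL (2 * m)) ++ doubledPart (suc (2 * m) % 4) _  ≡⟨ cong (map plus1 (BL (2 * m)) ++_) (doubledPart-odd m _) ⟩
  map plus1 (BL (2 * m)) ++ []                               ≡⟨ ++-identityʳ _ ⟩
  map plus1 (BL (2 * m))                                     ∎

BL-even : ∀ m → BL (2 * suc m) ≡ map plus1 (BL (suc (2 * m))) ++ doubledPart (2 * suc m % 4) (BL (suc m))
BL-even m = subst (λ n → BL n ≡ map plus1 (BL (suc (2 * m))) ++ doubledPart (n % 4) (BL (suc m))) (sym (*-suc 2 m))
  (trans (BL-suc (suc (2 * m)))
         (cong (λ n → map plus1 (BL (suc (2 * m))) ++ doubledPart ((2 + 2 * m) % 4) (BL n))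
               (trans (cong (_/ 2) (sym (*-suc 2 m))) (double/2 (suc m)))))

BL-induction : (P : ℕ → Partition → Set) → P 0 [] → (∀ {n x} → P n x → P (suc n) (plus1 x)) →
               (∀ {n y} → P n y → P (2 * n) (times2 y)) → ∀ n → All (P n) (BL n)
BL-induction P P[] P+1 P×2 = <-rec (λ n → All (P n) (BL n)) step
  where
  step : ∀ n → (∀ {m} → m < n → All (P m) (BL m)) → All (P n) (BL n)
  step n rec with evenOdd n
  ... | even zero = P[] ∷ []
  ... | even (suc m) = subst (All (P (2 * suc m))) (sym (BL-even m))
          (++⁺ (map⁺ (All.map (λ {x} → subst (λ k → P k (plus1 x)) (sym (*-suc 2 m)) ∘ P+1)
                               (rec (≤-reflexive (sym (*-suc 2 m))))))
               (All-doubledPart P×2 (2 * suc m % 4) (rec (s≤s (m<m+n m z<s)))))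
  ... | odd m = subst (All (P (suc (2 * m)))) (sym (BL-odd m)) (map⁺ (All.map P+1 (rec ≤-refl)))

sum-times2 : ∀ y → sum (times2 y) ≡ 2 * sum y
sum-times2 []      = refl
sum-times2 (a ∷ y) = trans (cong (2 * a +_) (sum-times2 y)) (sym (*-distribˡ-+ 2 a (sum y)))

sum-BL : ∀ n → All (λ x → sum x ≡ n) (BL n)
sum-BL = BL-induction (λ n x → sum x ≡ n) refl (cong suc) (λ {_} {y} p → trans (sum-times2 y) (cong (2 *_) p))

dropOnes : Partition → Partition
dropOnes = filter (λ x → ¬? (x ≟ 1))

times2-≢1 : ∀ y → All (_≢ 1) (times2 y)
times2-≢1 y = map⁺ (All.universal (λ a → even≢odd a 0) y)

dropOnes-times2 : ∀ y → dropOnes (times2 y) ≡ times2 y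
dropOnes-times2 y = filter-all (λ x → ¬? (x ≟ 1)) (times2-≢1 y)

1∉times2 : ∀ y → ¬ (1 ∈ times2 y)
1∉times2 y 1∈ with ∈-map⁻ (2 *_) 1∈
... | a , _ , 1≡2a = even≢odd a 0 (sym 1≡2a)

half-times2 : ∀ y → half (times2 y) ≡ dropOnes y
half-times2 y = cong dropOnes (trans (sym (map-∘ y)) (trans (map-cong double/2 y) (map-id y)))

OnesFirst : Partition → Set
OnesFirst x = ∃[ c ] x ≡ replicate c 1 ++ dropOnes x

sum-ones : ∀ c R → sum (replicate c 1 ++ R) ≡ c + sum R
sum-ones zero    R = refl
sum-ones (suc c) R = cong suc (sum-ones c R)

onesFirst-injective : ∀ {x y} → OnesFirst x → OnesFirst y → sum x ≡ sum y → dropOnes x ≡ dropOnes y → x ≡ y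
onesFirst-injective {x} {y} (c , x≡) (d , y≡) Σx≡Σy Dx≡Dy = begin
  x                            ≡⟨ x≡ ⟩
  replicate c 1 ++ dropOnes x  ≡⟨ cong₂ (λ n R → replicate n 1 ++ R) c≡d Dx≡Dy ⟩
  replicate d 1 ++ dropOnes y  ≡⟨ sym y≡ ⟩
  y                            ∎
  where
  c≡d : c ≡ d
  c≡d = +-cancelʳ-≡ (sum (dropOnes y)) c d (begin
    c + sum (dropOnes y)             ≡⟨ cong (λ R → c + sum R) (sym Dx≡Dy) ⟩
    c + sum (dropOnes x)             ≡⟨ sym (sum-ones c _) ⟩
    sum (replicate c 1 ++ dropOnes x) ≡⟨ cong sum (sym x≡) ⟩
    sum x                            ≡⟨ Σx≡Σy ⟩
    sum y                            ≡⟨ cong sum y≡ ⟩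
    sum (replicate d 1 ++ dropOnes y) ≡⟨ sum-ones d _ ⟩
    d + sum (dropOnes y)             ∎)

onesFirst-plus1 : ∀ {x} → OnesFirst x → OnesFirst (plus1 x)
onesFirst-plus1 (c , e) = suc c , cong (1 ∷_) e

onesFirst-times2 : ∀ y → OnesFirst (times2 y)
onesFirst-times2 y = 0 , sym (dropOnes-times2 y)

onesFirst-BL : ∀ n → All OnesFirst (BL n)
onesFirst-BL = BL-induction (λ _ → OnesFirst) (0 , refl) onesFirst-plus1 (λ {_} {y} _ → onesFirst-times2 y)

onesFirst-sorted : ∀ {Q} → Linked _≤_ Q → All (1 ≤_) Q → OnesFirst Q
onesFirst-sorted {[]}    _ _ = 0 , refl
onesFirst-sorted {q ∷ Q} sorted (1≤q ∷ 1≤Q) with q ≟ 1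
... | yes refl = onesFirst-plus1 (onesFirst-sorted (Linked.tail sorted) 1≤Q)
... | no q≢1   = 0 , sym (filter-all (λ x → ¬? (x ≟ 1)) (All.map (>⇒≢ {_} {1}) (Linked⇒All ≤-trans 1<q sorted)))
  where 1<q = ≤∧≢⇒< 1≤q (q≢1 ∘ sym)

b-odd : ∀ m → b (suc (2 * m)) ≡ b (2 * m)
b-odd m = trans (cong length (BL-odd m)) (length-map plus1 (BL (2 * m)))

b-even : ∀ m → b (2 * suc m) ≡ b (2 * m) + b (suc m)
b-even m = begin
  b (2 * suc m)                         ≡⟨ cong length (BL-even m) ⟩
  length (map plus1 xs ++ H)            ≡⟨ length-++ (map plus1 xs) ⟩
  length (map plus1 xs) + length H      ≡⟨ cong₂ _+_ (length-map plus1 xs) (length-doubledPart (suc m) (BL (suc m))) ⟩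
  b (suc (2 * m)) + b (suc m)           ≡⟨ cong (_+ b (suc m)) (b-odd m) ⟩
  b (2 * m) + b (suc m)                 ∎
  where
  xs = BL (suc (2 * m))
  H  = doubledPart (2 * suc m % 4) (BL (suc m))

b₋₂-double-suc : ∀ m → b₋₂ (2 * suc m) ≡ b (2 * m)
b₋₂-double-suc m = cong b₋₂ (*-suc 2 m)

b-double : ∀ m → b₋₂ (2 * m) + b m ≡ b (2 * m)
b-double zero    = refl
b-double (suc m) = trans (cong (_+ b (suc m)) (b₋₂-double-suc m)) (sym (b-even m))

b-≤-suc : ∀ n → b n ≤ b (suc n)
b-≤-suc n = subst₂ _≤_ (length-map plus1 (BL n)) (cong length (sym (BL-suc n))) (length-++-≤ˡ (map plus1 (BL n)))

b-mono : ∀ {m n} → m ≤ n → b m ≤ b n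
b-mono = b-mono′ ∘ ≤⇒≤′
  where
  b-mono′ : ∀ {m n} → m ≤′ n → b m ≤ b n
  b-mono′ ≤′-refl      = ≤-refl
  b-mono′ (≤′-step {n} le) = ≤-trans (b-mono′ le) (b-≤-suc n)

b-positive : ∀ n → 0 < b n
b-positive n = b-mono {0} {n} z≤n

<-b-double : ∀ m → m < b (2 * m)
<-b-double zero    = z<s
<-b-double (suc m) = subst (suc m <_) (sym (trans (b-even m) (+-comm (b (2 * m)) (b (suc m)))))
  (+-mono-≤ (b-positive (suc m)) (<-b-double m))

prefix-suc : ∀ m → prefix (suc m) ≡ prefix m ++ block (2 * suc m)
prefix-suc m = begin
  concatMap blockOf (upTo (suc (suc m)))          ≡⟨ cong (concatMap blockOf) (sym (upTo-∷ʳ (suc m))) ⟩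
  concatMap blockOf (upTo (suc m) ++ [ suc m ])   ≡⟨ concatMap-++ blockOf (upTo (suc m)) [ suc m ] ⟩
  prefix m ++ (block (2 * suc m) ++ [])           ≡⟨ cong (prefix m ++_) (++-identityʳ _) ⟩
  prefix m ++ block (2 * suc m)                   ∎
  where blockOf = λ j → block (2 * j)

block-doubledPart : ∀ m → block (2 * m) ≡ doubledPart (2 * m % 4) (BL m)
block-doubledPart zero    = refl
block-doubledPart (suc m) = begin
  filter no1? (BL (2 * suc m))                       ≡⟨ cong (filter no1?) (BL-even m) ⟩
  filter no1? (map plus1 xs ++ H)                    ≡⟨ filter-++ no1? (map plus1 xs) H ⟩
  filter no1? (map plus1 xs) ++ filter no1? H        ≡⟨ cong₂ _++_ (filter-none no1? plus1-has-1) (filter-all no1? H-no1) ⟩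
  H                                                  ∎
  where
  xs = BL (suc (2 * m))
  H  = doubledPart (2 * suc m % 4) (BL (suc m))
  no1? = λ (Q : Partition) → ¬? (1 ∈? Q)
  plus1-has-1 : All (λ Q → ¬ ¬ 1 ∈ Q) (map plus1 xs)
  plus1-has-1 = map⁺ (All.universal (λ _ 1∉ → 1∉ (here refl)) xs)
  H-no1 : All (λ Q → ¬ 1 ∈ Q) H
  H-no1 = All-doubledPart-times2 1∉times2 (2 * suc m % 4) (BL (suc m))

mutual
  dropOnes-BL-even : ∀ m → map dropOnes (BL (2 * m)) ≡ prefix m
  dropOnes-BL-even zero    = refl
  dropOnes-BL-even (suc m) = begin
    map dropOnes (BL (2 * suc m))                        ≡⟨ cong (map dropOnes) (BL-even m) ⟩
    map dropOnes (map plus1 xs ++ H)                     ≡⟨ map-++ dropOnes (map plus1 xs) H ⟩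
    map dropOnes (map plus1 xs) ++ map dropOnes H        ≡⟨ cong₂ _++_ (sym (map-∘ xs)) (map-id-local H-fixed) ⟩
    map dropOnes xs ++ H                                 ≡⟨ cong₂ _++_ (dropOnes-BL-odd m) (sym (block-doubledPart (suc m))) ⟩
    prefix m ++ block (2 * suc m)                        ≡⟨ sym (prefix-suc m) ⟩
    prefix (suc m)                                       ∎
    where
    xs = BL (suc (2 * m))
    H  = doubledPart (2 * suc m % 4) (BL (suc m))
    H-fixed : All (λ Q → dropOnes Q ≡ Q) H
    H-fixed = All-doubledPart-times2 dropOnes-times2 (2 * suc m % 4) (BL (suc m))

  dropOnes-BL-odd : ∀ m → map dropOnes (BL (suc (2 * m))) ≡ prefix m
  dropOnes-BL-odd m = begin
    map dropOnes (BL (suc (2 * m)))          ≡⟨ cong (map dropOnes) (BL-odd m) ⟩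
    map dropOnes (map plus1 (BL (2 * m)))    ≡⟨ sym (map-∘ (BL (2 * m))) ⟩
    map dropOnes (BL (2 * m))                ≡⟨ dropOnes-BL-even m ⟩
    prefix m                                 ∎

length-prefix : ∀ m → length (prefix m) ≡ b (2 * m)
length-prefix m = trans (cong length (sym (dropOnes-BL-even m))) (length-map dropOnes (BL (2 * m)))

prefix-++ : ∀ {m n} → m ≤′ n → ∃[ ys ] prefix n ≡ prefix m ++ ys
prefix-++ ≤′-refl = [] , sym (++-identityʳ _)
prefix-++ {m} (≤′-step {n} le) with prefix-++ le
... | ys , e = ys ++ block (2 * suc n) , (begin
  prefix (suc n)                            ≡⟨ prefix-suc n ⟩
  prefix n ++ block (2 * suc n)             ≡⟨ cong (_++ block (2 * suc n)) e ⟩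
  (prefix m ++ ys) ++ block (2 * suc n)     ≡⟨ ++-assoc (prefix m) ys _ ⟩
  prefix m ++ (ys ++ block (2 * suc n))     ∎)

nth-prefix-mono : ∀ {m n i} → m ≤ n → i < length (prefix m) → nth (prefix n) i ≡ nth (prefix m) i
nth-prefix-mono {m} {n} {i} m≤n i<len with prefix-++ (≤⇒≤′ m≤n)
... | ys , e = trans (cong (λ xs → nth xs i) e) (nth-++ˡ (prefix m) ys i<len)

𝓑-prefix : ∀ M {i x} → nth (prefix M) i ≡ just x → 𝓑 (suc i) ≡ x
𝓑-prefix M {i} {x} e = begin
  fromMaybe [] (nth (prefix (suc i)) i)      ≡⟨ cong (fromMaybe []) (sym (nth-prefix-mono {i = i} (m≤n+m (suc i) M) i<𝓑)) ⟩
  fromMaybe [] (nth (prefix (M + suc i)) i)  ≡⟨ cong (fromMaybe []) (nth-prefix-mono {i = i} (m≤m+n M (suc i)) i<M) ⟩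
  fromMaybe [] (nth (prefix M) i)            ≡⟨ cong (fromMaybe []) e ⟩
  x                                          ∎
  where
  i<M = nth-just⇒< (prefix M) e
  i<𝓑 : i < length (prefix (suc i))
  i<𝓑 = subst (i <_) (sym (length-prefix (suc i))) (<-trans (n<1+n i) (<-b-double (suc i)))

dropOnes-BL-prefix : ∀ n → ∃[ M ] map dropOnes (BL n) ≡ prefix M
dropOnes-BL-prefix n with evenOdd n
... | even m = m , dropOnes-BL-even m
... | odd m  = m , dropOnes-BL-odd m

dropOnes-BL : ∀ {n i y} → nth (BL n) i ≡ just y → dropOnes y ≡ 𝓑 (suc i)
dropOnes-BL {n} {i} {y} e with dropOnes-BL-prefix n
... | M , BL≡prefix = sym (𝓑-prefix M {i} (begin
  nth (prefix M) i               ≡⟨ cong (λ xs → nth xs i) (sym BL≡prefix) ⟩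
  nth (map dropOnes (BL n)) i    ≡⟨ nth-map-just dropOnes (BL n) e ⟩
  just (dropOnes y)              ∎))

𝓑-block : ∀ m {j x} → nth (doubledPart (2 * m % 4) (BL m)) j ≡ just x → 𝓑 (suc (b₋₂ (2 * m) + j)) ≡ x
𝓑-block zero {j} e = 𝓑-prefix 0 {j} e
𝓑-block (suc m) {j} {x} e = 𝓑-prefix (suc m) {b₋₂ (2 * suc m) + j} (begin
  nth (prefix (suc m)) (b₋₂ (2 * suc m) + j)                      ≡⟨ cong₂ nth (prefix-suc m) (cong (_+ j) L≡) ⟩
  nth (prefix m ++ block (2 * suc m)) (length (prefix m) + j)     ≡⟨ nth-++ʳ (prefix m) _ j ⟩
  nth (block (2 * suc m)) j                                       ≡⟨ cong (λ xs → nth xs j) (block-doubledPart (suc m)) ⟩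
  nth (doubledPart (2 * suc m % 4) (BL (suc m))) j                ≡⟨ e ⟩
  just x                                                          ∎)
  where
  L≡ : b₋₂ (2 * suc m) ≡ length (prefix m)
  L≡ = trans (b₋₂-double-suc m) (sym (length-prefix m))

𝓑-times2-≡0 : ∀ {m l y} → 2 * m % 4 ≡ 0 → nth (BL m) l ≡ just y → 𝓑 (suc (b₋₂ (2 * m) + l)) ≡ times2 y
𝓑-times2-≡0 {m} {l} {y} r≡0 e = 𝓑-block m
  (subst (λ r → nth (doubledPart r (BL m)) l ≡ just (times2 y)) (sym r≡0) (nth-map-just times2 (BL m) e))

𝓑-times2-≡2 : ∀ {m l y} → 2 * m % 4 ≡ 2 → nth (BL m) l ≡ just y → 𝓑 (suc (b₋₂ (2 * m) + (b m ∸ suc l))) ≡ times2 y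
𝓑-times2-≡2 {m} {l} {y} r≡2 e = 𝓑-block m
  (subst (λ r → nth (doubledPart r (BL m)) (b m ∸ suc l) ≡ just (times2 y)) (sym r≡2)
    (subst (λ n → nth (reverse (map times2 (BL m))) (n ∸ suc l) ≡ just (times2 y)) (length-map times2 (BL m))
      (nth-reverse-mirror (map times2 (BL m)) (nth-map-just times2 (BL m) e))))

block-position : ∀ i → ∃[ m ] ∃[ j ] j < b m × i ≡ b₋₂ (2 * m) + j
block-position zero = 0 , 0 , b-positive 0 , refl
block-position (suc i) with block-position i
... | m , j , j<b , refl with suc j <? b m
...   | yes 1+j<b = m , suc j , 1+j<b , sym (+-suc _ j)
...   | no 1+j≮b  = suc m , 0 , b-positive (suc m) , (begin
  suc (b₋₂ (2 * m) + j)   ≡⟨ sym (+-suc _ j) ⟩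
  b₋₂ (2 * m) + suc j     ≡⟨ cong (b₋₂ (2 * m) +_) (≤-antisym j<b (≮⇒≥ 1+j≮b)) ⟩
  b₋₂ (2 * m) + b m       ≡⟨ b-double m ⟩
  b (2 * m)               ≡⟨ sym (b₋₂-double-suc m) ⟩
  b₋₂ (2 * suc m)         ≡⟨ sym (+-identityʳ _) ⟩
  b₋₂ (2 * suc m) + 0     ∎)

b-least : ∀ {m k n} → b₋₂ (2 * m) < k → k ≤ b n → 2 * m ≤ n
b-least {zero} _ _ = z≤n
b-least {suc m} {k} {n} b₋₂<k k≤b with 2 * suc m ≤? n
... | yes 2m+2≤n = 2m+2≤n
... | no  2m+2≰n = ⊥-elim (<⇒≱ b₋₂<k (≤-trans k≤b bn≤b₋₂))
  where
  n≤2m+1 : n ≤ suc (2 * m)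
  n≤2m+1 = ≤-pred (subst (suc n ≤_) (*-suc 2 m) (≰⇒> 2m+2≰n))
  bn≤b₋₂ : b n ≤ b₋₂ (2 * suc m)
  bn≤b₋₂ = ≤-trans (b-mono n≤2m+1) (≤-reflexive (trans (b-odd m) (sym (b₋₂-double-suc m))))

𝓑-size : ∀ {m j} → j < b m → ∣ 𝓑 (suc (b₋₂ (2 * m) + j)) ∣ₚ ≡ 2 * m
𝓑-size {m} {j} j<b with nth-< (doubledPart (2 * m % 4) (BL m)) (subst (j <_) (sym (length-doubledPart m (BL m))) j<b)
... | x , e = trans (cong sum (𝓑-block m e))
                    (nth-All (All-doubledPart (λ {y} Σy≡m → trans (sum-times2 y) (cong (2 *_) Σy≡m)) (2 * m % 4) (sum-BL m)) e)

𝓑-fits : ∀ i → suc i ≤ b ∣ 𝓑 (suc i) ∣ₚ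
𝓑-fits i with block-position i
... | m , j , j<b , refl = subst (λ n → suc (b₋₂ (2 * m) + j) ≤ b n) (sym (𝓑-size {m} j<b)) k≤b[2m]
  where
  k≤b[2m] : suc (b₋₂ (2 * m) + j) ≤ b (2 * m)
  k≤b[2m] = subst₂ _≤_ (+-suc (b₋₂ (2 * m)) j) (b-double m) (+-monoʳ-≤ (b₋₂ (2 * m)) j<b)

𝓑-least : ∀ i n → suc i ≤ b n → ∣ 𝓑 (suc i) ∣ₚ ≤ n
𝓑-least i n k≤b with block-position i
... | m , j , j<b , refl = subst (_≤ n) (sym (𝓑-size {m} j<b)) (b-least {m} (s≤s (m≤m+n (b₋₂ (2 * m)) j)) k≤b)

half-𝓑-≡0 : ∀ i → ∣ 𝓑 (suc i) ∣ₚ % 4 ≡ 0 → half (𝓑 (suc i)) ≡ 𝓑 (suc i ∸ b₋₂ ∣ 𝓑 (suc i) ∣ₚ)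
half-𝓑-≡0 i r≡0 with block-position i
... | m , j , j<b , refl with nth-< (BL m) j<b
... | y , e = begin
  half (𝓑 (suc (L + j)))                  ≡⟨ cong half (𝓑-times2-≡0 {m} (subst (λ n → n % 4 ≡ 0) size r≡0) e) ⟩
  half (times2 y)                         ≡⟨ half-times2 y ⟩
  dropOnes y                              ≡⟨ dropOnes-BL {m} e ⟩
  𝓑 (suc j)                               ≡⟨ cong 𝓑 (sym index) ⟩
  𝓑 (suc (L + j) ∸ L)                     ≡⟨ cong (λ n → 𝓑 (suc (L + j) ∸ b₋₂ n)) (sym size) ⟩
  𝓑 (suc (L + j) ∸ b₋₂ ∣ 𝓑 (suc (L + j)) ∣ₚ) ∎
  where
  L = b₋₂ (2 * m)
  size = 𝓑-size {m} j<b
  index : suc (L + j) ∸ L ≡ suc j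
  index = trans (cong (_∸ L) (sym (+-suc L j))) (m+n∸m≡n L (suc j))

half-𝓑-≡2 : ∀ i → ∣ 𝓑 (suc i) ∣ₚ % 4 ≡ 2 → half (𝓑 (suc i)) ≡ 𝓑 (b ∣ 𝓑 (suc i) ∣ₚ + 1 ∸ suc i)
half-𝓑-≡2 i r≡2 with block-position i
... | m , j , j<b , refl with nth-< (BL m) (∸-suc-< j<b)
... | y , e = begin
  half (𝓑 (suc (L + j)))                           ≡⟨ cong (λ j′ → half (𝓑 (suc (L + j′)))) (sym (∸-suc-involutive j<b)) ⟩
  half (𝓑 (suc (L + (b m ∸ suc (b m ∸ suc j)))))   ≡⟨ cong half (𝓑-times2-≡2 {m} (subst (λ n → n % 4 ≡ 2) size r≡2) e) ⟩
  half (times2 y)                                  ≡⟨ half-times2 y ⟩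
  dropOnes y                                       ≡⟨ dropOnes-BL {m} e ⟩
  𝓑 (suc (b m ∸ suc j))                            ≡⟨ cong 𝓑 (sym index) ⟩
  𝓑 (b (2 * m) + 1 ∸ suc (L + j))                  ≡⟨ cong (λ n → 𝓑 (b n + 1 ∸ suc (L + j))) (sym size) ⟩
  𝓑 (b ∣ 𝓑 (suc (L + j)) ∣ₚ + 1 ∸ suc (L + j))      ∎
  where
  L = b₋₂ (2 * m)
  size = 𝓑-size {m} j<b
  index : b (2 * m) + 1 ∸ suc (L + j) ≡ suc (b m ∸ suc j)
  index = begin
    b (2 * m) + 1 ∸ suc (L + j)    ≡⟨ cong (λ n → n + 1 ∸ suc (L + j)) (sym (b-double m)) ⟩
    (L + b m) + 1 ∸ suc (L + j)    ≡⟨ cong (_∸ suc (L + j)) (+-comm _ 1) ⟩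
    (L + b m) ∸ (L + j)            ≡⟨ [m+n]∸[m+o]≡n∸o L (b m) j ⟩
    b m ∸ j                        ≡⟨ +-∸-assoc 1 j<b ⟩
    suc (b m ∸ suc j)              ∎

pow2-halve : ∀ {a} → IsPow2 a → 1 ≢ a → IsPow2 (a / 2) × 2 * (a / 2) ≡ a
pow2-halve (zero  , refl) 1≢1 = ⊥-elim (1≢1 refl)
pow2-halve (suc j , refl) _   = (j , double/2 (2 ^ j)) , cong (2 *_) (double/2 (2 ^ j))

evenBinary-halve : ∀ {P} → IsEvenBinaryPartition P → IsBinaryPartition (map (_/ 2) P) × times2 (map (_/ 2) P) ≡ P
evenBinary-halve {P} ((sorted , pow2) , 1∉P) =
  (Linked-map⁺ (Linked.map (/-monoˡ-≤ 2) sorted) , map⁺ (All.map proj₁ halves)) ,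
  trans (sym (map-∘ P)) (map-id-local (All.map proj₂ halves))
  where halves = All.zipWith (λ (p , q) → pow2-halve p q) (pow2 , ¬Any⇒All¬ P 1∉P)

onesFirst-binary : ∀ {Q} → IsBinaryPartition Q → OnesFirst Q
onesFirst-binary (sorted , pow2) = onesFirst-sorted sorted (All.map (λ { (j , refl) → m^n>0 2 j }) pow2)

sum-dropOnes-≤ : ∀ xs → sum (dropOnes xs) ≤ sum xs
sum-dropOnes-≤ []       = z≤n
sum-dropOnes-≤ (x ∷ xs) with x ≡ᵇ 1
... | true  = ≤-trans (sum-dropOnes-≤ xs) (m≤n+m _ x)
... | false = +-monoʳ-≤ x (sum-dropOnes-≤ xs)

-- P halved sits in 𝓑(|P|/2) at position ℓ − 1, which exists as ℓ ≤ b(|𝓑_ℓ|) ≤ b(|P|/2).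
evenBinary-in-BL : ∀ {P l} → IsEvenBinaryPartition P → half P ≡ 𝓑 (suc l) → ∃[ m ] ∃[ y ] nth (BL m) l ≡ just y × P ≡ times2 y
evenBinary-in-BL {P} {l} P-even half≡ = m , y , e , trans (sym Q×2≡P) (cong times2 (sym y≡Q))
  where
  Q = map (_/ 2) P
  m = sum Q
  Q-binary : IsBinaryPartition Q
  Q-binary = proj₁ (evenBinary-halve P-even)
  Q×2≡P : times2 Q ≡ P
  Q×2≡P = proj₂ (evenBinary-halve P-even)
  l<b : l < b m
  l<b = ≤-trans (𝓑-fits l) (b-mono (subst (_≤ m) (cong sum half≡) (sum-dropOnes-≤ Q)))
  y : Partition
  y = proj₁ (nth-< (BL m) l<b)
  e : nth (BL m) l ≡ just y
  e = proj₂ (nth-< (BL m) l<b)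
  y≡Q : y ≡ Q
  y≡Q = onesFirst-injective (nth-All {i = l} (onesFirst-BL m) e) (onesFirst-binary Q-binary)
          (nth-All {i = l} (sum-BL m) e) (trans (dropOnes-BL {m} {l} e) (sym half≡))

size-times2-BL : ∀ {m l y} → nth (BL m) l ≡ just y → ∣ times2 y ∣ₚ ≡ 2 * m
size-times2-BL {m} {l} {y} e = trans (sum-times2 y) (cong (2 *_) (nth-All {i = l} (sum-BL m) e))

𝓑-position-≡0 : ∀ {P l} → IsEvenBinaryPartition P → half P ≡ 𝓑 (suc l) →
                trail P 0 % 4 ≡ 0 → P ≡ 𝓑 (b₋₂ (trail P 0) + suc l)
𝓑-position-≡0 {l = l} P-even half≡ r≡0 with evenBinary-in-BL P-even half≡
... | m , y , e , refl = begin
  times2 y                           ≡⟨ sym (𝓑-times2-≡0 {m} (subst (λ n → n % 4 ≡ 0) |P|≡2m r≡0) e) ⟩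
  𝓑 (suc (b₋₂ (2 * m) + l))          ≡⟨ cong 𝓑 (sym (+-suc (b₋₂ (2 * m)) l)) ⟩
  𝓑 (b₋₂ (2 * m) + suc l)            ≡⟨ cong (λ n → 𝓑 (b₋₂ n + suc l)) (sym |P|≡2m) ⟩
  𝓑 (b₋₂ ∣ times2 y ∣ₚ + suc l)      ∎
  where |P|≡2m = size-times2-BL {m} {l} e

𝓑-position-≡2 : ∀ {P l} → IsEvenBinaryPartition P → half P ≡ 𝓑 (suc l) →
                trail P 0 % 4 ≡ 2 → P ≡ 𝓑 (b (trail P 0) + 1 ∸ suc l)
𝓑-position-≡2 {l = l} P-even half≡ r≡2 with evenBinary-in-BL P-even half≡
... | m , y , e , refl = begin
  times2 y                               ≡⟨ sym (𝓑-times2-≡2 {m} (subst (λ n → n % 4 ≡ 2) |P|≡2m r≡2) e) ⟩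
  𝓑 (suc (b₋₂ (2 * m) + (b m ∸ suc l)))  ≡⟨ cong 𝓑 (sym index) ⟩
  𝓑 (b (2 * m) + 1 ∸ suc l)              ≡⟨ cong (λ n → 𝓑 (b n + 1 ∸ suc l)) (sym |P|≡2m) ⟩
  𝓑 (b ∣ times2 y ∣ₚ + 1 ∸ suc l)        ∎
  where
  |P|≡2m = size-times2-BL {m} {l} e
  l<b : l < b m
  l<b = nth-just⇒< (BL m) e
  index : b (2 * m) + 1 ∸ suc l ≡ suc (b₋₂ (2 * m) + (b m ∸ suc l))
  index = begin
    b (2 * m) + 1 ∸ suc l                   ≡⟨ cong (λ n → n + 1 ∸ suc l) (sym (b-double m)) ⟩
    (b₋₂ (2 * m) + b m) + 1 ∸ suc l         ≡⟨ cong (_∸ suc l) (+-comm _ 1) ⟩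
    (b₋₂ (2 * m) + b m) ∸ l                 ≡⟨ +-∸-assoc (b₋₂ (2 * m)) (<⇒≤ l<b) ⟩
    b₋₂ (2 * m) + (b m ∸ l)                 ≡⟨ cong (b₋₂ (2 * m) +_) (+-∸-assoc 1 l<b) ⟩
    b₋₂ (2 * m) + suc (b m ∸ suc l)         ≡⟨ +-suc _ _ ⟩
    suc (b₋₂ (2 * m) + (b m ∸ suc l))       ∎

theorem3 : ((k : ℕ) → 1 ≤ k →
               (k ≤ b ∣ 𝓑 k ∣ₚ × ((m : ℕ) → k ≤ b m → ∣ 𝓑 k ∣ₚ ≤ m))
               × (∣ 𝓑 k ∣ₚ % 4 ≡ 0 → half (𝓑 k) ≡ 𝓑 (k ∸ b₋₂ ∣ 𝓑 k ∣ₚ))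
               × (∣ 𝓑 k ∣ₚ % 4 ≡ 2 → half (𝓑 k) ≡ 𝓑 (b ∣ 𝓑 k ∣ₚ + 1 ∸ k)))
             × ((P : Partition) → IsEvenBinaryPartition P → (ℓ : ℕ) → 1 ≤ ℓ →
               half P ≡ 𝓑 ℓ →
               (trail P 0 % 4 ≡ 0 → P ≡ 𝓑 (b₋₂ (trail P 0) + ℓ))
               × (trail P 0 % 4 ≡ 2 → P ≡ 𝓑 (b (trail P 0) + 1 ∸ ℓ)))
             × (𝓑 1 ≡ [])
theorem3 =
  (λ { (suc i) _ → (𝓑-fits i , 𝓑-least i) , half-𝓑-≡0 i , half-𝓑-≡2 i }) ,
  (λ { P P-even (suc l) _ half≡ → 𝓑-position-≡0 P-even half≡ , 𝓑-position-≡2 P-even half≡ }) ,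
  refl
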